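{- Let $V$ be a finite set, $\mathcal{R}$ a dense set of betweenness triplets on $V$, and $\sigma$ a linear ordering of $V$. Let $\{a,b,c,d\}\subseteq V$ be four vertices such that the triplet $bca\in\mathcal{R}$ (choosing $c$) is the only triplet of $\mathcal{R}[\{a,b,c,d\}]$ inconsistent with $\sigma$. Then $\mathcal{R}[\{a,b,c,d\}]$ is inconsistent, i.e. $\{a,b,c,d\}$ is a conflict.
   Context: A betweenness triplet on $\{a,b,c\}$ chooses one of its elements; $abc$ denotes the triplet choosing $b$. $\mathcal{R}$ is dense if it contains exactly one triplet on each 3-subset of $V$. A triplet $abc$ is consistent with a linear ordering $\sigma$ if $b$ lies between $a$ and $c$ in $\sigma$. A set of triplets on $S$ is consistent if some linear ordering of $S$ is consistent with all of them, inconsistent otherwise. $\mathcal{R}[C]=\{t\in\mathcal{R}:V(t)\subseteq C\}$. -}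

module Defs where

open import Data.Nat using (ℕ; _<_)
open import Data.Fin using (Fin)
open import Data.Product using (_×_; ∃)
open import Data.Sum using (_⊎_)
open import Data.Empty using (⊥)
open import Relation.Nullary using (¬_)
open import Relation.Binary.PropositionalEquality using (_≡_; _≢_)
open import Level using (0ℓ; suc)

-- A betweenness triplet on {x,y,z} choosing y is written as the ordered
-- triple (x , y , z) (ends x, z; middle y); the triples (x,y,z) and (z,y,x)
-- denote the same triplet, so a set of triplets is a predicate on ordered
-- triples that is closed under reversal and only holds on distinct elements.

Distinct3 : ∀ {n} → Fin n → Fin n → Fin n → Set
Distinct3 x y z = x ≢ y × y ≢ z × x ≢ z

record TripletSet (n : ℕ) : Set₁ where
  field
    _∶_∶_∈R  : Fin n → Fin n → Fin n → Set
    distinct : ∀ {x y z} → x ∶ y ∶ z ∈R → Distinct3 x y z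
    reverse  : ∀ {x y z} → x ∶ y ∶ z ∈R → z ∶ y ∶ x ∈R
open TripletSet public

ExactlyOne : Set → Set → Set → Set
ExactlyOne P Q S = (P ⊎ Q ⊎ S) × (P → Q → ⊥) × (P → S → ⊥) × (Q → S → ⊥)

Dense : ∀ {n} → TripletSet n → Set
Dense {n} R = ∀ (x y z : Fin n) → Distinct3 x y z →
  ExactlyOne (_∶_∶_∈R R y x z) (_∶_∶_∈R R x y z) (_∶_∶_∈R R x z y)

-- A linear ordering of a subset S ⊆ Fin n: an assignment of positions
-- injective on S (x precedes y iff σ x < σ y).
Subset : ℕ → Set₁
Subset n = Fin n → Set

InjectiveOn : ∀ {n} → Subset n → (Fin n → ℕ) → Set
InjectiveOn S σ = ∀ {x y} → S x → S y → σ x ≡ σ y → x ≡ y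

LinearOrdering : ℕ → Set
LinearOrdering n = ∃ λ (σ : Fin n → ℕ) → InjectiveOn (λ _ → Data.Unit.⊤) σ
  where import Data.Unit

-- triplet xyz is consistent with σ: y lies between x and z.
Between : ∀ {n} → (Fin n → ℕ) → Fin n → Fin n → Fin n → Set
Between σ x y z = (σ x < σ y × σ y < σ z) ⊎ (σ z < σ y × σ y < σ x)

Restrict : ∀ {n} → TripletSet n → Subset n → Fin n → Fin n → Fin n → Set
Restrict R C x y z = C x × C y × C z × _∶_∶_∈R R x y z

ConsistentOn : ∀ {n} → TripletSet n → Subset n → Set
ConsistentOn R C = ∃ λ (τ : _ → ℕ) → InjectiveOn C τ ×
  (∀ x y z → Restrict R C x y z → Between τ x y z)

Quad : ∀ {n} → Fin n → Fin n → Fin n → Fin n → Subset n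
Quad a b c d x = x ≡ a ⊎ x ≡ b ⊎ x ≡ c ⊎ x ≡ d

module Submission where

-- Compare σ with a hypothetical ordering τ of {a,b,c,d} consistent with R[{a,b,c,d}], and call
-- a pair discordant when σ and τ order it differently.  Two orderings that both put y between
-- x and z make the pairs xy, yz, xz all discordant or all concordant.  The triplets on {a,c,d}
-- and {b,c,d} are consistent with σ, so bc is discordant iff cd is, iff ca is.  As τ puts c
-- between b and a, so does σ: a contradiction.

open import Defs
open import Data.Nat using (ℕ; _<_)
open import Data.Nat.Properties using (_<?_; <-cmp; <-trans; <-asym; <⇒≢; >⇒≢)
open import Data.Fin using (Fin)
open import Data.Bool using (Bool; true; false; not; _xor_)
open import Data.Bool.Properties using (xor-annihilates-not)
open import Data.Product using (_×_; proj₁; proj₂; _,_)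
open import Data.Sum using (_⊎_; inj₁; inj₂)
import Data.Sum as Sum
open import Data.Empty using (⊥-elim)
open import Data.Unit using (tt)
open import Function using (_∘_)
open import Relation.Nullary using (Dec; ¬_; does; contradiction)
open import Relation.Nullary.Decidable using (dec-true; dec-false; decidable-stable; _×-dec_; _⊎-dec_)
open import Relation.Binary using (tri<; tri≈; tri>)
open import Relation.Binary.PropositionalEquality
  using (_≡_; _≢_; refl; sym; trans; cong; cong₂; ≢-sym; module ≡-Reasoning)

xor-cancelʳ : ∀ x y z → x xor z ≡ y xor z → x ≡ y
xor-cancelʳ false false _     _  = refl
xor-cancelʳ true  true  _     _  = refl
xor-cancelʳ false true  false ()
xor-cancelʳ false true  true  ()
xor-cancelʳ true  false false ()
xor-cancelʳ true  false true  ()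

module _ {n : ℕ} where

  between? : ∀ (σ : Fin n → ℕ) x y z → Dec (Between σ x y z)
  between? σ x y z = (σ x <? σ y ×-dec σ y <? σ z) ⊎-dec (σ z <? σ y ×-dec σ y <? σ x)

  between⇒≢ : ∀ (σ : Fin n → ℕ) {x y z} → Between σ x y z → σ x ≢ σ y × σ y ≢ σ z
  between⇒≢ σ (inj₁ (x<y , y<z)) = <⇒≢ x<y , <⇒≢ y<z
  between⇒≢ σ (inj₂ (z<y , y<x)) = >⇒≢ y<x , >⇒≢ z<y

  ascending : (Fin n → ℕ) → Fin n → Fin n → Bool
  ascending σ x y = does (σ x <? σ y)

  ascending-< : ∀ σ {x y} → σ x < σ y → ascending σ x y ≡ true
  ascending-< σ {x} {y} = dec-true (σ x <? σ y)

  ascending-> : ∀ σ {x y} → σ y < σ x → ascending σ x y ≡ false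
  ascending-> σ {x} {y} = dec-false (σ x <? σ y) ∘ <-asym

  ascending-swap : ∀ σ {x y} → σ x ≢ σ y → ascending σ y x ≡ not (ascending σ x y)
  ascending-swap σ {x} {y} σx≢σy with <-cmp (σ x) (σ y)
  ... | tri< x<y _ _ rewrite ascending-< σ x<y | ascending-> σ x<y = refl
  ... | tri≈ _ σx≡σy _ = ⊥-elim (σx≢σy σx≡σy)
  ... | tri> _ _ y<x rewrite ascending-< σ y<x | ascending-> σ y<x = refl

  between⇒ascending : ∀ σ {x y z} → Between σ x y z →
    ascending σ x y ≡ ascending σ y z × ascending σ x z ≡ ascending σ y z
  between⇒ascending σ (inj₁ (x<y , y<z))
    rewrite ascending-< σ x<y | ascending-< σ y<z | ascending-< σ (<-trans x<y y<z) = refl , refl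
  between⇒ascending σ (inj₂ (z<y , y<x))
    rewrite ascending-> σ y<x | ascending-> σ z<y | ascending-> σ (<-trans z<y y<x) = refl , refl

  ascending⇒between : ∀ σ {x y z} → σ x ≢ σ y → σ y ≢ σ z →
    ascending σ x y ≡ ascending σ y z → Between σ x y z
  ascending⇒between σ {x} {y} {z} σx≢σy σy≢σz asc with <-cmp (σ x) (σ y) | <-cmp (σ y) (σ z)
  ... | tri≈ _ σx≡σy _ | _              = ⊥-elim (σx≢σy σx≡σy)
  ... | _              | tri≈ _ σy≡σz _ = ⊥-elim (σy≢σz σy≡σz)
  ... | tri< x<y _ _   | tri< y<z _ _   = inj₁ (x<y , y<z)
  ... | tri> _ _ y<x   | tri> _ _ z<y   = inj₂ (z<y , y<x)
  ... | tri< x<y _ _   | tri> _ _ z<y   =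
    contradiction (trans (sym (ascending-< σ x<y)) (trans asc (ascending-> σ z<y))) λ ()
  ... | tri> _ _ y<x   | tri< y<z _ _   =
    contradiction (trans (sym (ascending-> σ y<x)) (trans asc (ascending-< σ y<z))) λ ()

  discordant : (Fin n → ℕ) → (Fin n → ℕ) → Fin n → Fin n → Bool
  discordant σ τ x y = ascending σ x y xor ascending τ x y

  discordant-swap : ∀ σ τ {x y} → σ x ≢ σ y → τ x ≢ τ y →
    discordant σ τ y x ≡ discordant σ τ x y
  discordant-swap σ τ {x} {y} σx≢σy τx≢τy =
    trans (cong₂ _xor_ (ascending-swap σ σx≢σy) (ascending-swap τ τx≢τy))
          (xor-annihilates-not (ascending σ x y) (ascending τ x y))

  Between₂ : (Fin n → ℕ) → (Fin n → ℕ) → Fin n → Fin n → Fin n → Set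
  Between₂ σ τ x y z = Between σ x y z × Between τ x y z

  between₂⇒discordant : ∀ σ τ {x y z} → Between₂ σ τ x y z →
    discordant σ τ x y ≡ discordant σ τ y z × discordant σ τ x z ≡ discordant σ τ y z
  between₂⇒discordant σ τ (σxyz , τxyz) with between⇒ascending σ σxyz | between⇒ascending τ τxyz
  ... | σxy≡σyz , σxz≡σyz | τxy≡τyz , τxz≡τyz = cong₂ _xor_ σxy≡σyz τxy≡τyz , cong₂ _xor_ σxz≡σyz τxz≡τyz

  discordant-triangle : ∀ σ τ {x y z} →
    Between₂ σ τ y x z ⊎ Between₂ σ τ x y z ⊎ Between₂ σ τ x z y →
    discordant σ τ x y ≡ discordant σ τ y z
  discordant-triangle σ τ (inj₁ b@(σyxz , τyxz)) with between₂⇒discordant σ τ b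
  ... | yx≡xz , yz≡xz =
    trans (discordant-swap σ τ (proj₁ (between⇒≢ σ σyxz)) (proj₁ (between⇒≢ τ τyxz)))
          (trans yx≡xz (sym yz≡xz))
  discordant-triangle σ τ (inj₂ (inj₁ b)) = proj₁ (between₂⇒discordant σ τ b)
  discordant-triangle σ τ (inj₂ (inj₂ b@(σxzy , τxzy))) with between₂⇒discordant σ τ b
  ... | _ , xy≡zy =
    trans xy≡zy (sym (discordant-swap σ τ (proj₂ (between⇒≢ σ σxzy)) (proj₂ (between⇒≢ τ τxzy))))

  between-transfer : ∀ σ τ {x y z} → Between τ x y z →
    discordant σ τ x y ≡ discordant σ τ y z → σ x ≢ σ y → σ y ≢ σ z → Between σ x y z
  between-transfer σ τ {x} {y} {z} τxyz xy≡yz σx≢σy σy≢σz =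
    ascending⇒between σ σx≢σy σy≢σz
      (xor-cancelʳ _ _ (ascending τ x y)
        (trans xy≡yz (cong (ascending σ y z xor_) (sym (proj₁ (between⇒ascending τ τxyz))))))

lemma11 : (n : ℕ) (R : TripletSet n) → Dense R → (σ : LinearOrdering n) →
    (a b c d : Fin n) → a ≢ b → a ≢ c → a ≢ d → b ≢ c → b ≢ d → c ≢ d →
    _∶_∶_∈R R b c a →
    ¬ Between (proj₁ σ) b c a →
    (∀ x y z → Restrict R (Quad a b c d) x y z →
    ¬ Between (proj₁ σ) x y z →
    (x ≡ b × y ≡ c × z ≡ a) ⊎ (x ≡ a × y ≡ c × z ≡ b)) →
    ¬ ConsistentOn R (Quad a b c d)
lemma11 n R dense (σ , σ-injective) a b c d _ a≢c a≢d b≢c b≢d c≢d bca σ∤bca only-bca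
        (τ , τ-injective , τ-consistent) =
  σ∤bca (between-transfer σ τ (τ-consistent b c a (b∈Q , c∈Q , a∈Q , bca)) bc≡ca
                          (σ-≢ b≢c) (σ-≢ (≢-sym a≢c)))
  where
  Q : Subset n
  Q = Quad a b c d

  a∈Q : Q a
  a∈Q = inj₁ refl
  b∈Q : Q b
  b∈Q = inj₂ (inj₁ refl)
  c∈Q : Q c
  c∈Q = inj₂ (inj₂ (inj₁ refl))
  d∈Q : Q d
  d∈Q = inj₂ (inj₂ (inj₂ refl))

  σ-≢ : ∀ {x y} → x ≢ y → σ x ≢ σ y
  σ-≢ x≢y = x≢y ∘ σ-injective tt tt

  τ-≢ : ∀ {x y} → Q x → Q y → x ≢ y → τ x ≢ τ y
  τ-≢ x∈Q y∈Q x≢y = x≢y ∘ τ-injective x∈Q y∈Q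

  Through-d : Fin n → Fin n → Fin n → Set
  Through-d x y z = x ≡ d ⊎ y ≡ d ⊎ z ≡ d

  through-d⇒not-bca : ∀ {x y z} → Through-d x y z →
    ¬ ((x ≡ b × y ≡ c × z ≡ a) ⊎ (x ≡ a × y ≡ c × z ≡ b))
  through-d⇒not-bca (inj₁ refl)        (inj₁ (d≡b , _))     = b≢d (sym d≡b)
  through-d⇒not-bca (inj₁ refl)        (inj₂ (d≡a , _))     = a≢d (sym d≡a)
  through-d⇒not-bca (inj₂ (inj₁ refl)) (inj₁ (_ , d≡c , _)) = c≢d (sym d≡c)
  through-d⇒not-bca (inj₂ (inj₁ refl)) (inj₂ (_ , d≡c , _)) = c≢d (sym d≡c)
  through-d⇒not-bca (inj₂ (inj₂ refl)) (inj₁ (_ , _ , d≡a)) = a≢d (sym d≡a)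
  through-d⇒not-bca (inj₂ (inj₂ refl)) (inj₂ (_ , _ , d≡b)) = b≢d (sym d≡b)

  through-d⇒between₂ : ∀ {x y z} → Through-d x y z → Restrict R Q x y z → Between₂ σ τ x y z
  through-d⇒between₂ {x} {y} {z} through r =
    decidable-stable (between? σ x y z) (through-d⇒not-bca through ∘ only-bca x y z r) ,
    τ-consistent x y z r

  discordant-via-d : ∀ {x y} → Q x → Q y → x ≢ y → x ≢ d → y ≢ d →
    discordant σ τ x y ≡ discordant σ τ y d
  discordant-via-d {x} {y} x∈Q y∈Q x≢y x≢d y≢d =
    discordant-triangle σ τ
      (Sum.map (λ r → through-d⇒between₂ (inj₂ (inj₂ refl)) (y∈Q , x∈Q , d∈Q , r))
        (Sum.map (λ r → through-d⇒between₂ (inj₂ (inj₂ refl)) (x∈Q , y∈Q , d∈Q , r))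
                 (λ r → through-d⇒between₂ (inj₂ (inj₁ refl)) (x∈Q , d∈Q , y∈Q , r)))
        (proj₁ (dense x y d (x≢y , y≢d , x≢d))))

  bc≡ca : discordant σ τ b c ≡ discordant σ τ c a
  bc≡ca = begin
    discordant σ τ b c ≡⟨ discordant-via-d b∈Q c∈Q b≢c b≢d c≢d ⟩
    discordant σ τ c d ≡⟨ sym (discordant-via-d a∈Q c∈Q a≢c a≢d c≢d) ⟩
    discordant σ τ a c ≡⟨ sym (discordant-swap σ τ (σ-≢ a≢c) (τ-≢ a∈Q c∈Q a≢c)) ⟩
    discordant σ τ c a ∎
    where open ≡-Reasoning
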